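{- Let $h,\ell>1$ be integers and let $X\subseteq V(\boxplus_{h\times\ell})$ with $|X|\le h+1$. If $\boxplus_{h\times\ell}- X$ has two good components, then it has at most one further connected component, and such a component has exactly one vertex.
   Context: $\boxplus_{h\times\ell}$ is the $(h\times\ell)$-grid: vertex set $\{1,\dots,h\}\times\{1,\dots,\ell\}$, with $(i,j)$ adjacent to $(i',j')$ iff $|i-i'|+|j-j'|=1$; column $j$ is the set $\{(i,j): 1\le i\le h\}$. A connected component of $\boxplus_{h\times\ell}-X$ is good if it contains at least one full column. -}

module Defs where

open import Data.Nat using (ℕ; ∣_-_∣; _+_)
open import Data.Fin using (Fin; toℕ)
open import Data.Product using (_×_; ∃-syntax)
open import Data.List using (List)
open import Data.List.Membership.Propositional using (_∉_)
open import Relation.Binary.PropositionalEquality using (_≡_)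
open import Relation.Binary.Construct.Closure.ReflexiveTransitive using (Star)

-- Vertices of the (h × ℓ)-grid (0-based indices: (row i, column j)).
Vertex : ℕ → ℕ → Set
Vertex h ℓ = Fin h × Fin ℓ

Adj : ∀ {h ℓ} → Vertex h ℓ → Vertex h ℓ → Set
Adj {h} {ℓ} (i Data.Product., j) (i' Data.Product., j') =
  ∣ toℕ i - toℕ i' ∣ + ∣ toℕ j - toℕ j' ∣ ≡ 1

EdgeMinus : ∀ {h ℓ} → List (Vertex h ℓ) → Vertex h ℓ → Vertex h ℓ → Set
EdgeMinus X a b = a ∉ X × b ∉ X × Adj a b

Conn : ∀ {h ℓ} → List (Vertex h ℓ) → Vertex h ℓ → Vertex h ℓ → Set
Conn X a b = a ∉ X × Star (EdgeMinus X) a b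

GoodComp : ∀ {h ℓ} → List (Vertex h ℓ) → Vertex h ℓ → Set
GoodComp {h} {ℓ} X u = ∃[ j ] ((i : Fin h) → Conn X u (i Data.Product., j))

{-# OPTIONS --safe #-}
-- Let a < b be full columns of the two good components. Every row meets X strictly between a and b
-- (otherwise the row would join the two components); these h barrier vertices are distinct, so as
-- |X| ≤ h + 1 at most one row contains a further vertex of X. A vertex w outside X and outside both
-- good components is separated within its row from column a and from column b, and the barrier
-- vertex can cause at most one of these separations, so the row of w contains a further vertex of X.
-- Hence the vertical neighbours of w lie in X (otherwise they would be such vertices in another row),
-- and two such vertices cannot exist: in different rows they give two rows with further vertices, in
-- the same row a neighbouring row would contain two vertices of X. Neighbours of w outside X would be
-- such vertices too, so the component of w is {w}.
module Submission where

open import Defs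
open import Data.Nat using (ℕ; _≤_; _+_)
open import Data.List using (List; length)
open import Data.List.Membership.Propositional using (_∉_)
open import Data.Product using (_×_)
open import Relation.Nullary using (¬_)
open import Relation.Binary.PropositionalEquality using (_≡_)

open import Data.Nat using (zero; suc; _<_; _⊓_; _⊔_; ∣_-_∣; s≤s; z≤n)
open import Data.Nat.Properties
open import Data.Fin using (Fin; toℕ; inject₁)
open import Data.Fin.Properties
  using (toℕ-injective; toℕ-inject₁; i≤inject₁[j]⇒i≤1+j; injective⇒≤) renaming (_≟_ to _≟ᶠ_)
open import Data.Fin.Induction using (<-weakInduction-startingFrom)
open import Data.Vec.Functional using (Vector; _∷_)
open import Data.Product using (∃-syntax; _,_; proj₁; proj₂)
open import Data.Product.Properties using (≡-dec)
open import Data.Sum using (_⊎_; inj₁; inj₂; map₂)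
open import Data.Empty using (⊥-elim)
open import Function using (_∘_)
open import Function.Definitions using (Injective)
open import Relation.Nullary using (Dec; yes; no)
open import Relation.Binary.Definitions using (Symmetric; tri<; tri≈; tri>)
open import Relation.Binary.PropositionalEquality using (_≢_; refl; sym; trans; cong; cong₂; subst; setoid)
open import Relation.Binary.Construct.Closure.ReflexiveTransitive using (Star; ε; _◅_; _◅◅_; reverse)
open import Data.List.Membership.Propositional using (_∈_)
open import Data.List.Membership.Setoid.Properties using (index-injective)
import Data.List.Membership.DecPropositional as DecMembership

injection⇒≤length : ∀ {m} {A : Set} {xs : List A} (g : Fin m → A) →
  Injective _≡_ _≡_ g → (∀ k → g k ∈ xs) → m ≤ length xs
injection⇒≤length g g-inj g∈xs =
  injective⇒≤ (λ {k} {k'} eq → g-inj (index-injective (setoid _) (g∈xs k) (g∈xs k') eq))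

∷-injective : ∀ {n} {A : Set} {x : A} {g : Vector A n} →
  (∀ k → x ≢ g k) → Injective _≡_ _≡_ g → Injective _≡_ _≡_ (x ∷ g)
∷-injective {x = x} {g} x∉g g-inj = inj
  where
  inj : Injective _≡_ _≡_ (x ∷ g)
  inj {Fin.zero} {Fin.zero} _ = refl
  inj {Fin.zero} {Fin.suc k} eq = ⊥-elim (x∉g k eq)
  inj {Fin.suc k} {Fin.zero} eq = ⊥-elim (x∉g k (sym eq))
  inj {Fin.suc k} {Fin.suc k'} eq = cong Fin.suc (g-inj eq)

∣n-1+n∣≡1 : ∀ n → ∣ n - suc n ∣ ≡ 1
∣n-1+n∣≡1 zero = refl
∣n-1+n∣≡1 (suc n) = ∣n-1+n∣≡1 n

Adj-sym : ∀ {h ℓ} → Symmetric (Adj {h} {ℓ})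
Adj-sym {x = i , j} {i' , j'} = trans (cong₂ _+_ (∣-∣-comm (toℕ i') (toℕ i)) (∣-∣-comm (toℕ j') (toℕ j)))

Adj-horizontal : ∀ {h ℓ} (i : Fin h) (j : Fin ℓ) → Adj (i , inject₁ j) (i , Fin.suc j)
Adj-horizontal i j rewrite ∣n-n∣≡0 (toℕ i) | toℕ-inject₁ j = ∣n-1+n∣≡1 (toℕ j)

Adj-vertical : ∀ {h ℓ} (i : Fin h) (j : Fin ℓ) → Adj (inject₁ i , j) (Fin.suc i , j)
Adj-vertical i j rewrite toℕ-inject₁ i | ∣n-n∣≡0 (toℕ j) = trans (+-identityʳ _) (∣n-1+n∣≡1 (toℕ i))

neighbourRow : ∀ {h ℓ} → 2 ≤ h → (r : Fin h) →
  ∃[ r' ] (r' ≢ r × ∀ (c : Fin ℓ) → Adj (r , c) (r' , c))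
neighbourRow {suc (suc h)} (s≤s (s≤s z≤n)) Fin.zero =
  Fin.suc Fin.zero , (λ ()) , Adj-vertical {suc h} Fin.zero
neighbourRow _ (Fin.suc i) =
  inject₁ i , (λ eq → 1+n≢n (trans (cong toℕ (sym eq)) (toℕ-inject₁ i))) ,
  λ c → Adj-sym {x = inject₁ i , c} (Adj-vertical i c)

module _ {h ℓ : ℕ} {X : List (Vertex h ℓ)} where

  EdgeMinus-sym : Symmetric (EdgeMinus X)
  EdgeMinus-sym {x} (x∉X , y∉X , adj) = y∉X , x∉X , Adj-sym {x = x} adj

  Conn-refl : ∀ {a} → a ∉ X → Conn X a a
  Conn-refl a∉X = a∉X , ε

  Conn-edge : ∀ {a b} → EdgeMinus X a b → Conn X a b
  Conn-edge e@(a∉X , _) = a∉X , e ◅ ε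

  Conn⇒∉ʳ : ∀ {a b} → Conn X a b → b ∉ X
  Conn⇒∉ʳ (a∉X , path) = ∉-along a∉X path
    where
    ∉-along : ∀ {a b} → a ∉ X → Star (EdgeMinus X) a b → b ∉ X
    ∉-along a∉X ε = a∉X
    ∉-along _ ((_ , a'∉X , _) ◅ path) = ∉-along a'∉X path

  Conn-sym : ∀ {a b} → Conn X a b → Conn X b a
  Conn-sym c@(_ , path) = Conn⇒∉ʳ c , reverse EdgeMinus-sym path

  Conn-trans : ∀ {a b c} → Conn X a b → Conn X b c → Conn X a c
  Conn-trans (a∉X , p) (_ , q) = a∉X , p ◅◅ q

_∈?_ : ∀ {h ℓ} (w : Vertex h ℓ) (X : List (Vertex h ℓ)) → Dec (w ∈ X)
_∈?_ = DecMembership._∈?_ (≡-dec _≟ᶠ_ _≟ᶠ_)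

RowBlocked : ∀ {h ℓ} → List (Vertex h ℓ) → Fin h → ℕ → ℕ → Set
RowBlocked X i lo hi = ∃[ k ] (lo ≤ toℕ k × toℕ k ≤ hi × (i , k) ∈ X)

RowBlocked-weaken : ∀ {h ℓ} {X : List (Vertex h ℓ)} {i lo hi lo' hi'} →
  lo' ≤ lo → hi ≤ hi' → RowBlocked X i lo hi → RowBlocked X i lo' hi'
RowBlocked-weaken lo'≤lo hi≤hi' (k , lo≤k , k≤hi , k∈X) =
  k , ≤-trans lo'≤lo lo≤k , ≤-trans k≤hi hi≤hi' , k∈X

rowWalk : ∀ {h ℓ} {X : List (Vertex h ℓ)} (i : Fin h) {c d : Fin ℓ} → toℕ c ≤ toℕ d →
  RowBlocked X i (toℕ c) (toℕ d) ⊎ Conn X (i , c) (i , d)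
rowWalk {ℓ = zero} _ {()}
rowWalk {ℓ = suc _} {X} i {c} c≤d = map₂ proj₂ (<-weakInduction-startingFrom P start step c≤d)
  where
  -- The bound c ≤ d is carried along because the induction step is not told that j ≥ c.
  P : Fin _ → Set
  P d = RowBlocked X i (toℕ c) (toℕ d) ⊎ (toℕ c ≤ toℕ d × Conn X (i , c) (i , d))

  start : P c
  start with (i , c) ∈? X
  ... | yes c∈X = inj₁ (c , ≤-refl , ≤-refl , c∈X)
  ... | no c∉X = inj₂ (≤-refl , Conn-refl c∉X)

  step : ∀ j → P (inject₁ j) → P (Fin.suc j)
  step j (inj₁ blocked) =
    inj₁ (RowBlocked-weaken ≤-refl (i≤inject₁[j]⇒i≤1+j {i = inject₁ j} ≤-refl) blocked)
  step j (inj₂ (c≤j , c⇝j)) with (i , Fin.suc j) ∈? X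
  ... | yes j+1∈X = inj₁ (Fin.suc j , i≤inject₁[j]⇒i≤1+j c≤j , ≤-refl , j+1∈X)
  ... | no j+1∉X =
    inj₂ (i≤inject₁[j]⇒i≤1+j c≤j , Conn-trans c⇝j (Conn-edge (Conn⇒∉ʳ c⇝j , j+1∉X , Adj-horizontal i j)))

rowCut : ∀ {h ℓ} {X : List (Vertex h ℓ)} {i : Fin h} {c d : Fin ℓ} →
  ¬ Conn X (i , c) (i , d) → RowBlocked X i (toℕ c ⊓ toℕ d) (toℕ c ⊔ toℕ d)
rowCut {i = i} {c} {d} c≁d with ≤-total (toℕ c) (toℕ d)
... | inj₁ c≤d with rowWalk i c≤d
...   | inj₁ blocked = RowBlocked-weaken (m⊓n≤m (toℕ c) (toℕ d)) (m≤n⊔m (toℕ c) (toℕ d)) blocked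
...   | inj₂ c⇝d = ⊥-elim (c≁d c⇝d)
rowCut {i = i} {c} {d} c≁d | inj₂ d≤c with rowWalk i d≤c
...   | inj₁ blocked = RowBlocked-weaken (m⊓n≤n (toℕ c) (toℕ d)) (m≤m⊔n (toℕ c) (toℕ d)) blocked
...   | inj₂ d⇝c = ⊥-elim (c≁d (Conn-sym d⇝c))

Stray : ∀ {h ℓ} → List (Vertex h ℓ) → (u v w : Vertex h ℓ) → Set
Stray X u v w = w ∉ X × ¬ Conn X u w × ¬ Conn X v w

module _ {h ℓ : ℕ} {X : List (Vertex h ℓ)} {u v : Vertex h ℓ} where

  Stray-swap : ∀ {w} → Stray X u v w → Stray X v u w
  Stray-swap (w∉X , u≁w , v≁w) = w∉X , v≁w , u≁w

  Stray-step : ∀ {w w'} → Stray X u v w → EdgeMinus X w w' → Stray X u v w'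
  Stray-step {w} {w'} (_ , u≁w , v≁w) e@(_ , w'∉X , _) =
    w'∉X , (λ u⇝w' → u≁w (Conn-trans u⇝w' w'⇝w)) , (λ v⇝w' → v≁w (Conn-trans v⇝w' w'⇝w))
    where
    w'⇝w : Conn X w' w
    w'⇝w = Conn-edge (EdgeMinus-sym {x = w} e)

  Stray-star : ∀ {w z} → Stray X u v w → Star (EdgeMinus X) w z → Stray X u v z
  Stray-star s ε = s
  Stray-star s (e ◅ path) = Stray-star (Stray-step s e) path

column-≢ : ∀ {h ℓ} {X : List (Vertex h ℓ)} {i : Fin h} {c k : Fin ℓ} →
  (i , c) ∉ X → (i , k) ∈ X → toℕ c ≢ toℕ k
column-≢ {X = X} {i} c∉X k∈X c≡k = c∉X (subst (λ j → (i , j) ∈ X) (sym (toℕ-injective c≡k)) k∈X)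

module SeparatedByColumns {h ℓ : ℕ} {X : List (Vertex h ℓ)} (|X|≤h+1 : length X ≤ h + 1)
  {u v : Vertex h ℓ} (u≁v : ¬ Conn X u v) {a b : Fin ℓ} (a<b : toℕ a < toℕ b)
  (u⇝a : ∀ i → Conn X u (i , a)) (v⇝b : ∀ i → Conn X v (i , b)) where

  barrier : ∀ i → ∃[ k ] (toℕ a < toℕ k × toℕ k < toℕ b × (i , k) ∈ X)
  barrier i with rowWalk i (<⇒≤ a<b)
  ... | inj₂ a⇝b = ⊥-elim (u≁v (Conn-trans (u⇝a i) (Conn-trans a⇝b (Conn-sym (v⇝b i)))))
  ... | inj₁ (k , a≤k , k≤b , k∈X) =
    k , ≤∧≢⇒< a≤k (column-≢ (Conn⇒∉ʳ (u⇝a i)) k∈X) ,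
    ≤∧≢⇒< k≤b (column-≢ (Conn⇒∉ʳ (v⇝b i)) k∈X ∘ sym) , k∈X

  barrierColumn : Fin h → Fin ℓ
  barrierColumn i = proj₁ (barrier i)

  a<barrier : ∀ i → toℕ a < toℕ (barrierColumn i)
  a<barrier i = proj₁ (proj₂ (barrier i))

  barrier<b : ∀ i → toℕ (barrierColumn i) < toℕ b
  barrier<b i = proj₁ (proj₂ (proj₂ (barrier i)))

  barrier∈X : ∀ i → (i , barrierColumn i) ∈ X
  barrier∈X i = proj₂ (proj₂ (proj₂ (barrier i)))

  Extra : Fin h → Set
  Extra r = ∃[ e ] (e ≢ barrierColumn r × (r , e) ∈ X)

  extraRow-unique : ∀ {r r'} → Extra r → Extra r' → r ≡ r'
  extraRow-unique {r} {r'} (e , e≢ , re∈X) (e' , e'≢ , r'e'∈X) with r ≟ᶠ r'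
  ... | yes r≡r' = r≡r'
  ... | no r≢r' =
    ⊥-elim (1+n≰n (≤-trans (injection⇒≤length g g-inj g∈X) (≤-trans |X|≤h+1 (≤-reflexive (+-comm h 1)))))
    where
    barrierVertex : Fin h → Vertex h ℓ
    barrierVertex i = i , barrierColumn i

    extra≢barrier : ∀ {r e} → e ≢ barrierColumn r → ∀ i → (r , e) ≢ barrierVertex i
    extra≢barrier e≢ i refl = e≢ refl

    g : Vector (Vertex h ℓ) (2 + h)
    g = (r , e) ∷ (r' , e') ∷ barrierVertex

    g-inj : Injective _≡_ _≡_ g
    g-inj = ∷-injective
      (λ { Fin.zero → r≢r' ∘ cong proj₁ ; (Fin.suc i) → extra≢barrier e≢ i })
      (∷-injective (extra≢barrier e'≢) (cong proj₁))

    g∈X : ∀ k → g k ∈ X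
    g∈X Fin.zero = re∈X
    g∈X (Fin.suc Fin.zero) = r'e'∈X
    g∈X (Fin.suc (Fin.suc i)) = barrier∈X i

  two∈X⇒Extra : ∀ {r p q} → p ≢ q → (r , p) ∈ X → (r , q) ∈ X → Extra r
  two∈X⇒Extra {r} {p} {q} p≢q p∈X q∈X with p ≟ᶠ barrierColumn r
  ... | yes refl = q , p≢q ∘ sym , q∈X
  ... | no p≢barrier = p , p≢barrier , p∈X

  stray⇒Extra : ∀ {r c} → Stray X u v (r , c) → Extra r
  stray⇒Extra {r} {c} (c∉X , u≁c , v≁c) with <-cmp (toℕ c) (toℕ (barrierColumn r))
  ... | tri< c<p _ _ = extraLeft (rowCut λ c⇝a → u≁c (Conn-trans (u⇝a r) (Conn-sym c⇝a)))
    where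
    extraLeft : RowBlocked X r (toℕ c ⊓ toℕ a) (toℕ c ⊔ toℕ a) → Extra r
    extraLeft (k , _ , k≤c⊔a , k∈X) =
      k , (λ k≡p → <⇒≢ (≤-<-trans k≤c⊔a (⊔-pres-<m c<p (a<barrier r))) (cong toℕ k≡p)) , k∈X
  ... | tri≈ _ c≡p _ = ⊥-elim (column-≢ c∉X (barrier∈X r) c≡p)
  ... | tri> _ _ p<c = extraRight (rowCut λ c⇝b → v≁c (Conn-trans (v⇝b r) (Conn-sym c⇝b)))
    where
    extraRight : RowBlocked X r (toℕ c ⊓ toℕ b) (toℕ c ⊔ toℕ b) → Extra r
    extraRight (k , c⊓b≤k , _ , k∈X) =
      k , (λ k≡p → <⇒≢ (<-≤-trans (⊓-pres-m< p<c (barrier<b r)) c⊓b≤k) (cong toℕ (sym k≡p))) , k∈X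

  stray-neighbour∈X : ∀ {r c r' c'} → Stray X u v (r , c) → Adj (r , c) (r' , c') → r' ≢ r →
    (r' , c') ∈ X
  stray-neighbour∈X {r' = r'} {c'} s@(w∉X , _) adj r'≢r with (r' , c') ∈? X
  ... | yes w'∈X = w'∈X
  ... | no w'∉X =
    ⊥-elim (r'≢r (extraRow-unique (stray⇒Extra (Stray-step s (w∉X , w'∉X , adj))) (stray⇒Extra s)))

  stray-unique : 2 ≤ h → ∀ {w w'} → Stray X u v w → Stray X u v w' → w ≡ w'
  stray-unique h≥2 {r , c} {r' , c'} s s' with extraRow-unique (stray⇒Extra s) (stray⇒Extra s')
  ... | refl with c ≟ᶠ c'
  ...   | yes refl = refl
  ...   | no c≢c' with neighbourRow h≥2 r
  ...     | n , n≢r , n-adj =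
    ⊥-elim (n≢r (extraRow-unique
      (two∈X⇒Extra c≢c' (stray-neighbour∈X s (n-adj c) n≢r) (stray-neighbour∈X s' (n-adj c') n≢r))
      (stray⇒Extra s)))

stray-unique : ∀ {h ℓ} {X : List (Vertex h ℓ)} {u v : Vertex h ℓ} → 2 ≤ h → length X ≤ h + 1 →
  ¬ Conn X u v → GoodComp X u → GoodComp X v → ∀ {w w'} → Stray X u v w → Stray X u v w' → w ≡ w'
stray-unique {u = u} h≥2 |X|≤h+1 u≁v (a , u⇝a) (b , v⇝b) with <-cmp (toℕ a) (toℕ b)
... | tri< a<b _ _ = SeparatedByColumns.stray-unique |X|≤h+1 u≁v a<b u⇝a v⇝b h≥2
... | tri> _ _ b<a = λ s s' →
  SeparatedByColumns.stray-unique |X|≤h+1 (u≁v ∘ Conn-sym) b<a v⇝b u⇝a h≥2 (Stray-swap s) (Stray-swap s')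
... | tri≈ _ a≡b _ with toℕ-injective a≡b
...   | refl = ⊥-elim (u≁v (Conn-trans (u⇝a (proj₁ u)) (Conn-sym (v⇝b (proj₁ u)))))

lemma4p23 : (h ℓ : ℕ) → 2 ≤ h → 2 ≤ ℓ →
    (X : List (Vertex h ℓ)) → length X ≤ h + 1 →
    (u v : Vertex h ℓ) → u ∉ X → v ∉ X → ¬ Conn X u v →
    GoodComp X u → GoodComp X v →
    ((w w' : Vertex h ℓ) → w ∉ X → ¬ Conn X u w → ¬ Conn X v w →
      w' ∉ X → ¬ Conn X u w' → ¬ Conn X v w' → Conn X w w')
    × ((w z : Vertex h ℓ) → w ∉ X → ¬ Conn X u w → ¬ Conn X v w →
      Conn X w z → z ≡ w)
lemma4p23 _ _ h≥2 _ X |X|≤h+1 u v _ _ u≁v goodᵤ goodᵥ =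
    (λ w w' w∉X u≁w v≁w w'∉X u≁w' v≁w' →
      subst (Conn X w) (unique (w∉X , u≁w , v≁w) (w'∉X , u≁w' , v≁w')) (Conn-refl w∉X))
  , (λ w z w∉X u≁w v≁w (_ , w⇝z) →
      let s = w∉X , u≁w , v≁w in sym (unique s (Stray-star s w⇝z)))
  where
  unique : ∀ {w w'} → Stray X u v w → Stray X u v w' → w ≡ w'
  unique = stray-unique h≥2 |X|≤h+1 u≁v goodᵤ goodᵥ
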